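{- Let $K$ be a valued field with valuation $v$ and value group $V$, let $0\le\delta\in V$, and let $x_1,\ldots,x_n\in K$ with $\varepsilon:=v(x_1+\cdots+x_n)-\min_i\{v(x_i)\}$ satisfying $0<\varepsilon\in V$. If $\gamma\in V$ with $\gamma\geq\delta+\varepsilon$, and $\mathbf{z}\in\mathrm{RV}_\gamma$ satisfies $\mathrm{rv}_\gamma(x_1)+\cdots+\mathrm{rv}_\gamma(x_n)\approx\mathbf{z}$, then $\mathrm{rv}_{\gamma\to\delta}(\mathbf{z})=\mathrm{rv}_\delta(x_1+\cdots+x_n)$.
   Context: $\mathcal{O}$ is the valuation ring, $\mathfrak{m}_\delta=\{x\in\mathcal{O}: v(x)>\delta\}$, $\mathrm{RV}_\delta=K^\times/(1+\mathfrak{m}_\delta)$ with quotient map $\mathrm{rv}_\delta$, extended by $\mathrm{rv}_\delta(0)=\infty$. For $\gamma\ge\delta\ge 0$, $\mathrm{rv}_{\gamma\to\delta}:\mathrm{RV}_\gamma\to\mathrm{RV}_\delta$ is the natural map induced by $1+\mathfrak{m}_\gamma\subseteq1+\mathfrak{m}_\delta$. For $\mathbf{x}_1,\ldots,\mathbf{x}_n,\mathbf{z}\in\mathrm{RV}_\gamma$, $\mathbf{x}_1+\cdots+\mathbf{x}_n\approx\mathbf{z}$ means there exist $u_i\in K$ with $\mathrm{rv}_\gamma(u_i)=\mathbf{x}_i$ and $\mathrm{rv}_\gamma(u_1+\cdots+u_n)=\mathbf{z}$. -}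

module Defs where

open import Level using (Level; _⊔_) renaming (suc to lsuc)
open import Algebra.Bundles using (CommutativeRing; AbelianGroup)
open import Relation.Binary.Structures using (IsTotalOrder)
open import Relation.Nullary using (¬_)
open import Data.Product using (Σ; ∃; _×_; _,_)
open import Data.Sum using (_⊎_; inj₁; inj₂)
open import Data.Nat using (ℕ; zero; suc)
open import Data.Fin using (Fin; zero; suc)
open import Data.Unit.Polymorphic using (⊤)
open import Data.Empty.Polymorphic using (⊥)

record OrderedAbelianGroup (b ℓ : Level) : Set (lsuc (b ⊔ ℓ)) where
  field
    abGroup : AbelianGroup b ℓ
  open AbelianGroup abGroup public
    renaming (_∙_ to _+_; ε to 0#; _⁻¹ to -_)
  field
    _≤_            : Carrier → Carrier → Set ℓ
    isTotalOrder   : IsTotalOrder _≈_ _≤_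
    +-monoˡ-≤      : ∀ {x y} z → x ≤ y → (x + z) ≤ (y + z)

  _<_ : Carrier → Carrier → Set ℓ
  x < y = (x ≤ y) × ¬ (x ≈ y)

data Ext {b} (V : Set b) : Set b where
  fin : V → Ext V
  ∞   : Ext V

module ExtOps {b ℓ} (G : OrderedAbelianGroup b ℓ) where
  open OrderedAbelianGroup G

  _≈ₑ_ : Ext Carrier → Ext Carrier → Set ℓ
  fin x ≈ₑ fin y = x ≈ y
  fin x ≈ₑ ∞     = ⊥
  ∞     ≈ₑ fin y = ⊥
  ∞     ≈ₑ ∞     = ⊤

  _≤ₑ_ : Ext Carrier → Ext Carrier → Set ℓ
  fin x ≤ₑ fin y = x ≤ y
  fin x ≤ₑ ∞     = ⊤
  ∞     ≤ₑ fin y = ⊥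
  ∞     ≤ₑ ∞     = ⊤

  _<ₑ_ : Ext Carrier → Ext Carrier → Set ℓ
  fin x <ₑ fin y = x < y
  fin x <ₑ ∞     = ⊤
  ∞     <ₑ _     = ⊥

  _+ₑ_ : Ext Carrier → Ext Carrier → Ext Carrier
  fin x +ₑ fin y = fin (x + y)
  fin x +ₑ ∞     = ∞
  ∞     +ₑ _     = ∞

  minₑ : Ext Carrier → Ext Carrier → Ext Carrier
  minₑ (fin x) (fin y) with IsTotalOrder.total isTotalOrder x y
  ... | inj₁ _ = fin x
  ... | inj₂ _ = fin y
  minₑ (fin x) ∞ = fin x
  minₑ ∞ y = y

  minᵢ : ∀ {n} → (Fin n → Ext Carrier) → Ext Carrier
  minᵢ {zero}  f = ∞
  minᵢ {suc n} f = minₑ (f zero) (minᵢ (λ i → f (suc i)))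

record ValuedField (a ℓ₁ b ℓ₂ : Level) : Set (lsuc (a ⊔ ℓ₁ ⊔ b ⊔ ℓ₂)) where
  field
    cring : CommutativeRing a ℓ₁
  open CommutativeRing cring public hiding (zero)
  field
    1≉0     : ¬ (1# ≈ 0#)
    inverse : ∀ x → ¬ (x ≈ 0#) → ∃ λ y → (x * y) ≈ 1#
  field
    valueGroup : OrderedAbelianGroup b ℓ₂
  module V = OrderedAbelianGroup valueGroup
  open ExtOps valueGroup public
  field
    v          : Carrier → Ext V.Carrier
    v-cong     : ∀ {x y} → x ≈ y → v x ≈ₑ v y
    v-∞        : ∀ x → (v x ≈ₑ ∞ → x ≈ 0#) × (x ≈ 0# → v x ≈ₑ ∞)
    v-*        : ∀ x y → v (x * y) ≈ₑ (v x +ₑ v y)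
    v-+        : ∀ x y → minₑ (v x) (v y) ≤ₑ v (x + y)
    -- V is the value group: every element is a value
    v-surj     : ∀ γ → ∃ λ x → v x ≈ₑ fin γ

  Σᵢ : ∀ {n} → (Fin n → Carrier) → Carrier
  Σᵢ {zero}  f = 0#
  Σᵢ {suc n} f = f zero + Σᵢ (λ i → f (suc i))

  -- 𝔪_γ = { x ∈ 𝒪 : v(x) > γ }   (for γ ≥ 0 this forces x ∈ 𝒪)
  𝔪 : V.Carrier → Carrier → Set ℓ₂
  𝔪 γ x = fin V.0# ≤ₑ v x × fin γ <ₑ v x

  -- RV_γ = K^× / (1 + 𝔪_γ) together with ∞ = rv_γ(0).
  -- An element of RV_γ is represented by any x ∈ K with rv_γ(x) equal to it;
  -- x ~[ γ ] y  means  rv_γ(x) = rv_γ(y).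
  _~[_]_ : Carrier → V.Carrier → Carrier → Set (a ⊔ ℓ₁ ⊔ ℓ₂)
  x ~[ γ ] y = (x ≈ 0# × y ≈ 0#)
             ⊎ (¬ (x ≈ 0#) × ¬ (y ≈ 0#) × ∃ λ m → 𝔪 γ m × x ≈ (y * (1# + m)))

  -- x₁ + ⋯ + xₙ ≈ z in RV_γ, all given by representatives in K:
  -- there are uᵢ with rv_γ(uᵢ) = rv_γ(xᵢ) and rv_γ(u₁+⋯+uₙ) = rv_γ(z).
  SumApprox : ∀ {n} → V.Carrier → (Fin n → Carrier) → Carrier → Set (a ⊔ ℓ₁ ⊔ ℓ₂)
  SumApprox γ xs z = ∃ λ (u : Fin _ → Carrier) → (∀ i → u i ~[ γ ] xs i) × (Σᵢ u ~[ γ ] z)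

module Submission where

-- Write X = Σ xᵢ, s = v(X), m = min v(xᵢ), and let uᵢ, U = Σ uᵢ witness
-- rv_γ(x₁) + ⋯ + rv_γ(xₙ) ≈ z.  The proof works with the relation
-- x ~[ δ ] y, i.e. rv_δ(x) = rv_δ(y), and uses four facts about it:
--   * it is an equivalence relation for δ ≥ 0, because 1 + 𝔪_δ is a
--     multiplicative group (closed under products and inverses);
--   * it coarsens as δ decreases;
--   * x ~[ γ ] y with v(y) ≥ m forces v(x − y) > m + γ;
--   * v(x − y) > v(y) + δ forces x ~[ δ ] y.
-- Summing the third fact over i gives v(U − X) > m + γ ≥ s + δ, so U ~[ δ ] X
-- by the fourth; U ~[ γ ] z gives U ~[ δ ] z, and z ~[ δ ] X follows by
-- symmetry and transitivity.

open import Defs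
open import Level using (Level)
open import Function using (_∘_)
open import Data.Nat using (ℕ; zero; suc)
open import Data.Fin using (Fin; zero; suc)
open import Data.Product using (_×_; _,_; proj₁; proj₂; ∃)
open import Data.Sum using (_⊎_; inj₁; inj₂)
open import Data.Unit.Polymorphic using (tt)
open import Data.Empty.Polymorphic using (⊥-elim)
open import Relation.Nullary using (¬_; contradiction)
open import Relation.Binary.Bundles using (Poset)
open import Relation.Binary.Structures using (IsTotalOrder; IsPreorder)
open import Relation.Binary.Definitions using (Asymmetric; Trans; _Respects₂_)
open import Algebra.Bundles using (CommutativeRing)
import Relation.Binary.Construct.NonStrictToStrict as NonStrictToStrict
import Relation.Binary.Reasoning.Base.Triple as TripleReasoning
import Relation.Binary.Reasoning.PartialOrder as PosetReasoning
import Relation.Binary.Reasoning.Setoid as SetoidReasoning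
import Algebra.Solver.CommutativeMonoid as CommutativeMonoidSolver

module OrderedGroupFacts {b ℓ} (G : OrderedAbelianGroup b ℓ) where
  open OrderedAbelianGroup G
  open ExtOps G
  open IsTotalOrder isTotalOrder public
    using (total; antisym)
    renaming (refl to ≤-refl; reflexive to ≤-reflexive; trans to ≤-trans)
  open import Algebra.Properties.Group group using (∙-cancelˡ)
  open NonStrictToStrict _≈_ _≤_ using (<-asym)

  poset : Poset b ℓ ℓ
  poset = record { isPartialOrder = IsTotalOrder.isPartialOrder isTotalOrder }

  open Poset poset using (≤-respˡ-≈; ≤-respʳ-≈)
  module ≤-Reasoning = PosetReasoning poset

  <-≤-trans : Trans _<_ _≤_ _<_
  <-≤-trans = NonStrictToStrict.<-≤-trans _≈_ _≤_ sym ≤-trans antisym ≤-respʳ-≈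

  ≤-<-trans : Trans _≤_ _<_ _<_
  ≤-<-trans = NonStrictToStrict.≤-<-trans _≈_ _≤_ ≤-trans antisym ≤-respˡ-≈

  +-monoʳ-≤ : ∀ z {x y} → x ≤ y → (z + x) ≤ (z + y)
  +-monoʳ-≤ z {x} {y} x≤y = ≤-respˡ-≈ (comm x z) (≤-respʳ-≈ (comm y z) (+-monoˡ-≤ z x≤y))

  +-mono-≤-< : ∀ {x y u w} → x ≤ y → u < w → (x + u) < (y + w)
  +-mono-≤-< {x} {y} {u} {w} x≤y (u≤w , u≉w) =
    ≤-<-trans (+-monoˡ-≤ u x≤y) (+-monoʳ-≤ y u≤w , u≉w ∘ ∙-cancelˡ y u w)

  x+x≈0⇒x≈0 : ∀ x → (x + x) ≈ 0# → x ≈ 0#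
  x+x≈0⇒x≈0 x x+x≈0 with total x 0#
  ... | inj₁ x≤0 = antisym x≤0 (begin
      0#      ≈⟨ x+x≈0 ⟨
      x + x   ≤⟨ +-monoˡ-≤ x x≤0 ⟩
      0# + x  ≈⟨ identityˡ x ⟩
      x       ∎)
    where open ≤-Reasoning
  ... | inj₂ 0≤x = antisym (begin
      x       ≈⟨ identityˡ x ⟨
      0# + x  ≤⟨ +-monoˡ-≤ x 0≤x ⟩
      x + x   ≈⟨ x+x≈0 ⟩
      0#      ∎) 0≤x
    where open ≤-Reasoning

  x≤x+t : ∀ x {t} → 0# ≤ t → x ≤ (x + t)
  x≤x+t x {t} 0≤t = ≤-respˡ-≈ (identityʳ x) (+-monoʳ-≤ x 0≤t)

  -- Rearranging the hypothesis γ ≥ δ + (s − m) of the theorem to s + δ ≤ m + γ.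
  x+[y-z]≤w⇒y+x≤z+w : ∀ {x y z w} → (x + (y - z)) ≤ w → (y + x) ≤ (z + w)
  x+[y-z]≤w⇒y+x≤z+w {x} {y} {z} {w} x+[y-z]≤w = begin
      y + x               ≈⟨ identityʳ (y + x) ⟨
      (y + x) + 0#        ≈⟨ ∙-congˡ (inverseʳ z) ⟨
      (y + x) + (z - z)   ≈⟨ solve 4 (λ y x z z⁻ → (y ⊕ x) ⊕ (z ⊕ z⁻) ⊜ z ⊕ (x ⊕ (y ⊕ z⁻))) refl y x z (- z) ⟩
      z + (x + (y - z))   ≤⟨ +-monoʳ-≤ z x+[y-z]≤w ⟩
      z + w               ∎
    where
    open ≤-Reasoning
    open CommutativeMonoidSolver commutativeMonoid using (solve; _⊕_; _⊜_)

  -- These relations compute by pattern matching, so Agda cannot infer their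
  -- arguments; where they are implicit they are passed explicitly.

  ≈ₑ-refl : ∀ {p} → p ≈ₑ p
  ≈ₑ-refl {fin _} = refl
  ≈ₑ-refl {∞}     = tt

  ≈ₑ-sym : ∀ {p q} → p ≈ₑ q → q ≈ₑ p
  ≈ₑ-sym {fin _} {fin _} x≈y = sym x≈y
  ≈ₑ-sym {∞}     {∞}     _   = tt

  ≈ₑ-trans : ∀ {p q r} → p ≈ₑ q → q ≈ₑ r → p ≈ₑ r
  ≈ₑ-trans {fin _} {fin _} {fin _} x≈y y≈z = trans x≈y y≈z
  ≈ₑ-trans {∞}     {∞}     {∞}     _   _   = tt

  ≤ₑ-reflexive : ∀ {p q} → p ≈ₑ q → p ≤ₑ q
  ≤ₑ-reflexive {fin _} {fin _} x≈y = ≤-reflexive x≈y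
  ≤ₑ-reflexive {fin _} {∞}     _   = tt
  ≤ₑ-reflexive {∞}     {∞}     _   = tt

  ≤ₑ-trans : ∀ {p q r} → p ≤ₑ q → q ≤ₑ r → p ≤ₑ r
  ≤ₑ-trans {fin _} {fin _} {fin _} x≤y y≤z = ≤-trans x≤y y≤z
  ≤ₑ-trans {fin _} {_}     {∞}     _   _   = tt
  ≤ₑ-trans {∞}     {∞}     {∞}     _   _   = tt

  <ₑ⇒≤ₑ : ∀ {p q} → p <ₑ q → p ≤ₑ q
  <ₑ⇒≤ₑ {fin _} {fin _} (x≤y , _) = x≤y
  <ₑ⇒≤ₑ {fin _} {∞}     _         = tt

  <ₑ-≤ₑ-trans : ∀ {p q r} → p <ₑ q → q ≤ₑ r → p <ₑ r
  <ₑ-≤ₑ-trans {fin _} {fin _} {fin _} x<y y≤z = <-≤-trans x<y y≤z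
  <ₑ-≤ₑ-trans {fin _} {_}     {∞}     _   _   = tt

  ≤ₑ-<ₑ-trans : ∀ {p q r} → p ≤ₑ q → q <ₑ r → p <ₑ r
  ≤ₑ-<ₑ-trans {fin _} {fin _} {fin _} x≤y y<z = ≤-<-trans x≤y y<z
  ≤ₑ-<ₑ-trans {fin _} {_}     {∞}     _   _   = tt

  <ₑ-trans : ∀ {p q r} → p <ₑ q → q <ₑ r → p <ₑ r
  <ₑ-trans {p} {q} {r} p<q q<r = <ₑ-≤ₑ-trans {p} {q} {r} p<q (<ₑ⇒≤ₑ {q} {r} q<r)

  <ₑ-asym : Asymmetric _<ₑ_
  <ₑ-asym {fin _} {fin _} x<y y<x = <-asym antisym x<y y<x

  <ₑ-resp-≈ₑ : _<ₑ_ Respects₂ _≈ₑ_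
  <ₑ-resp-≈ₑ = (λ {p} {q} {r} q≈r p<q → <ₑ-≤ₑ-trans {p} {q} {r} p<q (≤ₑ-reflexive {q} {r} q≈r))
             , (λ {p} {q} {r} q≈r q<p → ≤ₑ-<ₑ-trans {r} {q} {p} (≤ₑ-reflexive {r} {q} (≈ₑ-sym {q} {r} q≈r)) q<p)

  ≤ₑ-isPreorder : IsPreorder _≈ₑ_ _≤ₑ_
  ≤ₑ-isPreorder = record
    { isEquivalence = record
        { refl  = λ {p} → ≈ₑ-refl {p}
        ; sym   = λ {p} {q} → ≈ₑ-sym {p} {q}
        ; trans = λ {p} {q} {r} → ≈ₑ-trans {p} {q} {r}
        }
    ; reflexive     = λ {p} {q} → ≤ₑ-reflexive {p} {q}
    ; trans         = λ {p} {q} {r} → ≤ₑ-trans {p} {q} {r}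
    }

  module ExtReasoning = TripleReasoning ≤ₑ-isPreorder
    (λ {p} {q} → <ₑ-asym {p} {q})
    (λ {p} {q} {r} → <ₑ-trans {p} {q} {r})
    <ₑ-resp-≈ₑ
    (λ {p} {q} → <ₑ⇒≤ₑ {p} {q})
    (λ {p} {q} {r} → <ₑ-≤ₑ-trans {p} {q} {r})
    (λ {p} {q} {r} → ≤ₑ-<ₑ-trans {p} {q} {r})

  ≤ₑ-antisym-fin : ∀ p {x} → p ≤ₑ fin x → fin x ≤ₑ p → p ≈ₑ fin x
  ≤ₑ-antisym-fin (fin _) p≤x x≤p = antisym p≤x x≤p

  minₑ-greatest-≤ : ∀ {c} p q → fin c ≤ₑ p → fin c ≤ₑ q → fin c ≤ₑ minₑ p q
  minₑ-greatest-≤ (fin x) (fin y) c≤x c≤y with total x y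
  ... | inj₁ _ = c≤x
  ... | inj₂ _ = c≤y
  minₑ-greatest-≤ (fin _) ∞ c≤x _   = c≤x
  minₑ-greatest-≤ ∞       _ _   c≤q = c≤q

  minₑ-greatest-< : ∀ {c} p q → fin c <ₑ p → fin c <ₑ q → fin c <ₑ minₑ p q
  minₑ-greatest-< (fin x) (fin y) c<x c<y with total x y
  ... | inj₁ _ = c<x
  ... | inj₂ _ = c<y
  minₑ-greatest-< (fin _) ∞ c<x _   = c<x
  minₑ-greatest-< ∞       _ _   c<q = c<q

  minₑ-≤ˡ : ∀ p q → minₑ p q ≤ₑ p
  minₑ-≤ˡ (fin x) (fin y) with total x y
  ... | inj₁ _   = ≤-refl
  ... | inj₂ y≤x = y≤x
  minₑ-≤ˡ (fin _) ∞       = ≤-refl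
  minₑ-≤ˡ ∞       (fin _) = tt
  minₑ-≤ˡ ∞       ∞       = tt

  minₑ-≤ʳ : ∀ p q → minₑ p q ≤ₑ q
  minₑ-≤ʳ (fin x) (fin y) with total x y
  ... | inj₁ x≤y = x≤y
  ... | inj₂ _   = ≤-refl
  minₑ-≤ʳ (fin _) ∞ = tt
  minₑ-≤ʳ ∞       q = ≤ₑ-reflexive {q} {q} (≈ₑ-refl {q})

  minₑ-≤-split : ∀ p q {r} → minₑ p q ≤ₑ r → (p ≤ₑ r) ⊎ (q ≤ₑ r)
  minₑ-≤-split (fin x) (fin y) min≤r with total x y
  ... | inj₁ _ = inj₁ min≤r
  ... | inj₂ _ = inj₂ min≤r
  minₑ-≤-split (fin _) ∞ min≤r = inj₁ min≤r
  minₑ-≤-split ∞       _ min≤r = inj₂ min≤r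

  minᵢ-≤ : ∀ {n} (f : Fin n → Ext Carrier) (i : Fin n) → minᵢ f ≤ₑ f i
  minᵢ-≤ f zero    = minₑ-≤ˡ (f zero) (minᵢ (f ∘ suc))
  minᵢ-≤ f (suc i) = ≤ₑ-trans {minᵢ f} {minᵢ (f ∘ suc)} {f (suc i)}
    (minₑ-≤ʳ (f zero) (minᵢ (f ∘ suc))) (minᵢ-≤ (f ∘ suc) i)

  +ₑ-congʳ : ∀ p {x} q → p ≈ₑ fin x → (p +ₑ q) ≈ₑ (fin x +ₑ q)
  +ₑ-congʳ (fin _) (fin y) p≈x = ∙-congʳ p≈x
  +ₑ-congʳ (fin _) ∞       _   = tt

  +ₑ-identityˡ : ∀ p → (fin 0# +ₑ p) ≈ₑ p
  +ₑ-identityˡ (fin x) = identityˡ x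
  +ₑ-identityˡ ∞       = tt

  +ₑ-mono-≤-< : ∀ {x y} p q → fin x ≤ₑ p → fin y <ₑ q → fin (x + y) <ₑ (p +ₑ q)
  +ₑ-mono-≤-< (fin _) (fin _) x≤p y<q = +-mono-≤-< x≤p y<q
  +ₑ-mono-≤-< (fin _) ∞       _   _   = tt
  +ₑ-mono-≤-< ∞       _       _   _   = tt

  +ₑ-idempotent⇒0 : ∀ p → (p +ₑ p) ≈ₑ p → ¬ (p ≈ₑ ∞) → p ≈ₑ fin 0#
  +ₑ-idempotent⇒0 (fin x) x+x≈x _   = sym (∙-cancelˡ x 0# x (trans (identityʳ x) (sym x+x≈x)))
  +ₑ-idempotent⇒0 ∞       _     p≉∞ = contradiction tt p≉∞

  +ₑ-torsionFree : ∀ p → (p +ₑ p) ≈ₑ fin 0# → p ≈ₑ fin 0#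
  +ₑ-torsionFree (fin x) x+x≈0 = x+x≈0⇒x≈0 x x+x≈0

  +ₑ-inverseʳ-unique : ∀ {x} q → (fin x +ₑ q) ≈ₑ fin 0# → q ≈ₑ fin (- x)
  +ₑ-inverseʳ-unique {x} (fin y) x+y≈0 = inverseʳ-unique x y x+y≈0
    where open import Algebra.Properties.Group group using (inverseʳ-unique)

module CommutativeRingFacts {c ℓ} (R : CommutativeRing c ℓ) where
  open CommutativeRing R
  open SetoidReasoning setoid
  open import Algebra.Properties.Group +-group using (//-rightDividesʳ)
  open import Algebra.Properties.AbelianGroup +-abelianGroup using (xyx⁻¹≈y)
  open import Algebra.Solver.Ring.NaturalCoefficients.Default commutativeSemiring
    using (solve; _:=_; _:+_; _:*_; con)

  -- If w inverts 1 + x, then 1 − wx = w, so w is itself of the form 1 + y.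
  [1+x]w≈1⇒1-wx≈w : ∀ {x w} → ((1# + x) * w) ≈ 1# → (1# + - (w * x)) ≈ w
  [1+x]w≈1⇒1-wx≈w {x} {w} [1+x]w≈1 = begin
    1# + - (w * x)            ≈⟨ +-congʳ [1+x]w≈1 ⟨
    (1# + x) * w + - (w * x)  ≈⟨ +-congʳ (solve 2 (λ x w → (con 1 :+ x) :* w := w :+ w :* x) refl x w) ⟩
    (w + w * x) + - (w * x)   ≈⟨ //-rightDividesʳ (w * x) w ⟩
    w                         ∎

  *-[1+]-invert : ∀ {x y a b} → x ≈ (y * (1# + a)) → ((1# + a) * (1# + b)) ≈ 1# → y ≈ (x * (1# + b))
  *-[1+]-invert {x} {y} {a} {b} x≈y[1+a] [1+a][1+b]≈1 = begin
    y                            ≈⟨ *-identityʳ y ⟨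
    y * 1#                       ≈⟨ *-congˡ [1+a][1+b]≈1 ⟨
    y * ((1# + a) * (1# + b))    ≈⟨ *-assoc y (1# + a) (1# + b) ⟨
    (y * (1# + a)) * (1# + b)    ≈⟨ *-congʳ x≈y[1+a] ⟨
    x * (1# + b)                 ∎

  *-[1+]-compose : ∀ {x y z a b} → x ≈ (y * (1# + a)) → y ≈ (z * (1# + b)) →
                   x ≈ (z * (1# + ((b + a) + b * a)))
  *-[1+]-compose {x} {y} {z} {a} {b} x≈y[1+a] y≈z[1+b] = begin
    x                              ≈⟨ x≈y[1+a] ⟩
    y * (1# + a)                   ≈⟨ *-congʳ y≈z[1+b] ⟩
    (z * (1# + b)) * (1# + a)      ≈⟨ solve 3 (λ z a b → (z :* (con 1 :+ b)) :* (con 1 :+ a)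
                                        := z :* (con 1 :+ ((b :+ a) :+ b :* a))) refl z a b ⟩
    z * (1# + ((b + a) + b * a))   ∎

  x≈y[1+a]⇒x-y≈ya : ∀ {x y a} → x ≈ (y * (1# + a)) → (x - y) ≈ (y * a)
  x≈y[1+a]⇒x-y≈ya {x} {y} {a} x≈y[1+a] = begin
    x - y                ≈⟨ +-congʳ x≈y[1+a] ⟩
    y * (1# + a) - y     ≈⟨ +-congʳ (solve 2 (λ y a → y :* (con 1 :+ a) := y :+ y :* a) refl y a) ⟩
    (y + y * a) - y      ≈⟨ xyx⁻¹≈y y (y * a) ⟩
    y * a                ∎

  y+[x-y]≈x : ∀ x y → (y + (x - y)) ≈ x
  y+[x-y]≈x x y = begin
    y + (x - y)   ≈⟨ +-assoc y x (- y) ⟨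
    (y + x) - y   ≈⟨ xyx⁻¹≈y y x ⟩
    x             ∎

  x≈y[1+y⁻¹[x-y]] : ∀ {x y y⁻¹} → (y * y⁻¹) ≈ 1# → x ≈ (y * (1# + y⁻¹ * (x - y)))
  x≈y[1+y⁻¹[x-y]] {x} {y} {y⁻¹} yy⁻¹≈1 = begin
    x                            ≈⟨ y+[x-y]≈x x y ⟨
    y + (x - y)                  ≈⟨ +-congˡ (*-identityˡ (x - y)) ⟨
    y + 1# * (x - y)             ≈⟨ +-congˡ (*-congʳ yy⁻¹≈1) ⟨
    y + (y * y⁻¹) * (x - y)      ≈⟨ solve 3 (λ y y⁻¹ d → y :+ (y :* y⁻¹) :* d := y :* (con 1 :+ y⁻¹ :* d)) refl y y⁻¹ (x - y) ⟩
    y * (1# + y⁻¹ * (x - y))     ∎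

  [u+u']-[x+x']≈[u-x]+[u'-x'] : ∀ u u' x x' → ((u + u') - (x + x')) ≈ ((u - x) + (u' - x'))
  [u+u']-[x+x']≈[u-x]+[u'-x'] u u' x x' = begin
    (u + u') - (x + x')        ≈⟨ +-congˡ (⁻¹-∙-comm x x') ⟨
    (u + u') + (- x + - x')    ≈⟨ solve 4 (λ u u' x⁻ x'⁻ → (u :+ u') :+ (x⁻ :+ x'⁻) := (u :+ x⁻) :+ (u' :+ x'⁻)) refl u u' (- x) (- x') ⟩
    (u - x) + (u' - x')        ∎
    where open import Algebra.Properties.AbelianGroup +-abelianGroup using (⁻¹-∙-comm)

module ValuedFieldFacts {k ℓ₁ g ℓ₂} (F : ValuedField k ℓ₁ g ℓ₂) where
  open ValuedField F
  open OrderedGroupFacts valueGroup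
  open CommutativeRingFacts cring
  open import Algebra.Properties.Ring ring using (-1*x≈-x; -‿involutive)
  open import Algebra.Properties.Group +-group using (//-rightDividesʳ)
  open ExtReasoning

  v-zero : ∀ {x} → x ≈ 0# → v x ≈ₑ ∞
  v-zero {x} = proj₂ (v-∞ x)

  v-zero-> : ∀ {c x} → x ≈ 0# → fin c <ₑ v x
  v-zero-> {c} {x} x≈0 = begin-strict fin c <⟨ tt ⟩ ∞ ≈⟨ v-zero x≈0 ⟨ v x ∎

  nonzero : ∀ x {s} → v x ≈ₑ fin s → ¬ (x ≈ 0#)
  nonzero x {s} vx≈s x≈0 = ⊥-elim (begin-equality fin s ≈⟨ vx≈s ⟨ v x ≈⟨ v-zero x≈0 ⟩ ∞ ∎)

  -- v(1) = 0, since v(1) = v(1) + v(1) is finite.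
  v-1 : v 1# ≈ₑ fin V.0#
  v-1 = +ₑ-idempotent⇒0 (v 1#) v1+v1≈v1 (1≉0 ∘ proj₁ (v-∞ 1#))
    where
    v1+v1≈v1 : (v 1# +ₑ v 1#) ≈ₑ v 1#
    v1+v1≈v1 = begin-equality
      v 1# +ₑ v 1#  ≈⟨ v-* 1# 1# ⟨
      v (1# * 1#)   ≈⟨ v-cong (*-identityˡ 1#) ⟩
      v 1#          ∎

  -- v(−1) = 0, since 2·v(−1) = v(1) = 0 and V is torsion-free.
  v-[-1] : v (- 1#) ≈ₑ fin V.0#
  v-[-1] = +ₑ-torsionFree (v (- 1#)) (begin-equality
    v (- 1#) +ₑ v (- 1#)  ≈⟨ v-* (- 1#) (- 1#) ⟨
    v (- 1# * - 1#)       ≈⟨ v-cong (trans (-1*x≈-x (- 1#)) (-‿involutive 1#)) ⟩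
    v 1#                  ≈⟨ v-1 ⟩
    fin V.0#              ∎)

  v-neg : ∀ x → v (- x) ≈ₑ v x
  v-neg x = begin-equality
    v (- x)            ≈⟨ v-cong (-1*x≈-x x) ⟨
    v (- 1# * x)       ≈⟨ v-* (- 1#) x ⟩
    v (- 1#) +ₑ v x    ≈⟨ +ₑ-congʳ (v (- 1#)) (v x) v-[-1] ⟩
    fin V.0# +ₑ v x    ≈⟨ +ₑ-identityˡ (v x) ⟩
    v x                ∎

  v-inverse : ∀ x y {s} → (x * y) ≈ 1# → v x ≈ₑ fin s → v y ≈ₑ fin (V.- s)
  v-inverse x y {s} xy≈1 vx≈s = +ₑ-inverseʳ-unique (v y) (begin-equality
    fin s +ₑ v y  ≈⟨ +ₑ-congʳ (v x) (v y) vx≈s ⟨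
    v x +ₑ v y    ≈⟨ v-* x y ⟨
    v (x * y)     ≈⟨ v-cong xy≈1 ⟩
    v 1#          ≈⟨ v-1 ⟩
    fin V.0#      ∎)

  v-*-> : ∀ {c d} x y → fin c ≤ₑ v x → fin d <ₑ v y → fin (c V.+ d) <ₑ v (x * y)
  v-*-> {c} {d} x y c≤vx d<vy = begin-strict
    fin (c V.+ d)  <⟨ +ₑ-mono-≤-< (v x) (v y) c≤vx d<vy ⟩
    v x +ₑ v y     ≈⟨ v-* x y ⟨
    v (x * y)      ∎

  v-+-≥ : ∀ {c} x y → fin c ≤ₑ v x → fin c ≤ₑ v y → fin c ≤ₑ v (x + y)
  v-+-≥ {c} x y c≤vx c≤vy = begin
    fin c              ≤⟨ minₑ-greatest-≤ (v x) (v y) c≤vx c≤vy ⟩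
    minₑ (v x) (v y)   ≤⟨ v-+ x y ⟩
    v (x + y)          ∎

  v-+-> : ∀ {c} x y → fin c <ₑ v x → fin c <ₑ v y → fin c <ₑ v (x + y)
  v-+-> {c} x y c<vx c<vy = begin-strict
    fin c              <⟨ minₑ-greatest-< (v x) (v y) c<vx c<vy ⟩
    minₑ (v x) (v y)   ≤⟨ v-+ x y ⟩
    v (x + y)          ∎

  v-+-dominant : ∀ x e {s} → v x ≈ₑ fin s → fin s <ₑ v e → v (x + e) ≈ₑ fin s
  v-+-dominant x e {s} vx≈s s<ve = ≤ₑ-antisym-fin (v (x + e)) upper lower
    where
    s≤vx : fin s ≤ₑ v x
    s≤vx = begin fin s ≈⟨ vx≈s ⟨ v x ∎

    lower : fin s ≤ₑ v (x + e)
    lower = v-+-≥ x e s≤vx (<ₑ⇒≤ₑ {fin s} {v e} s<ve)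

    -- x = (x + e) + (−e), so one of v(x + e), v(−e) is at most s.
    min≤s : minₑ (v (x + e)) (v (- e)) ≤ₑ fin s
    min≤s = begin
      minₑ (v (x + e)) (v (- e))  ≤⟨ v-+ (x + e) (- e) ⟩
      v ((x + e) + - e)           ≈⟨ v-cong (//-rightDividesʳ e x) ⟩
      v x                         ≈⟨ vx≈s ⟩
      fin s                       ∎

    upper : v (x + e) ≤ₑ fin s
    upper with minₑ-≤-split (v (x + e)) (v (- e)) min≤s
    ... | inj₁ v[x+e]≤s = v[x+e]≤s
    ... | inj₂ v[-e]≤s  = begin-contradiction
      fin s     <⟨ s<ve ⟩
      v e       ≈⟨ v-neg e ⟨
      v (- e)   ≤⟨ v[-e]≤s ⟩
      fin s     ∎

  Σᵢ-error : ∀ {n c} (u x : Fin n → Carrier) →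
             (∀ i → fin c <ₑ v (u i - x i)) → fin c <ₑ v (Σᵢ u - Σᵢ x)
  Σᵢ-error {zero}      u x _    = v-zero-> (-‿inverseʳ 0#)
  Σᵢ-error {suc _} {c} u x errs = begin-strict
    fin c                                                    <⟨ v-+-> (u zero - x zero) (Σᵢ (u ∘ suc) - Σᵢ (x ∘ suc))
                                                                  (errs zero) (Σᵢ-error (u ∘ suc) (x ∘ suc) (errs ∘ suc)) ⟩
    v ((u zero - x zero) + (Σᵢ (u ∘ suc) - Σᵢ (x ∘ suc)))    ≈⟨ v-cong ([u+u']-[x+x']≈[u-x]+[u'-x'] (u zero) _ (x zero) _) ⟨
    v (Σᵢ u - Σᵢ x)                                          ∎

  𝔪-intro : ∀ {δ} → V.0# V.≤ δ → ∀ x → fin δ <ₑ v x → 𝔪 δ x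
  𝔪-intro {δ} 0≤δ x δ<vx = (begin fin V.0# ≤⟨ 0≤δ ⟩ fin δ <⟨ δ<vx ⟩ v x ∎) , δ<vx

  𝔪-mono : ∀ {δ γ x} → δ V.≤ γ → 𝔪 γ x → 𝔪 δ x
  𝔪-mono {δ} {γ} {x} δ≤γ (0≤vx , γ<vx) = 0≤vx , (begin-strict fin δ ≤⟨ δ≤γ ⟩ fin γ <⟨ γ<vx ⟩ v x ∎)

  𝔪-product : ∀ {δ x y} → V.0# V.≤ δ → 𝔪 δ x → 𝔪 δ y → 𝔪 δ ((x + y) + x * y)
  𝔪-product {δ} {x} {y} 0≤δ (0≤vx , δ<vx) (_ , δ<vy) =
    𝔪-intro 0≤δ ((x + y) + x * y) (v-+-> (x + y) (x * y) (v-+-> x y δ<vx δ<vy) δ<vxy)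
    where
    δ<vxy : fin δ <ₑ v (x * y)
    δ<vxy = begin-strict
      fin δ              ≈⟨ V.identityˡ δ ⟨
      fin (V.0# V.+ δ)   <⟨ v-*-> x y 0≤vx δ<vy ⟩
      v (x * y)          ∎

  𝔪-inverse : ∀ {δ x} → V.0# V.≤ δ → 𝔪 δ x → ∃ λ y → 𝔪 δ y × ((1# + x) * (1# + y)) ≈ 1#
  𝔪-inverse {δ} {x} 0≤δ (_ , δ<vx) = y , 𝔪-intro 0≤δ y δ<vy , trans (*-congˡ ([1+x]w≈1⇒1-wx≈w [1+x]w≈1)) [1+x]w≈1
    where
    v[1+x] : v (1# + x) ≈ₑ fin V.0#
    v[1+x] = v-+-dominant 1# x v-1 (begin-strict fin V.0# ≤⟨ 0≤δ ⟩ fin δ <⟨ δ<vx ⟩ v x ∎)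

    w : Carrier
    w = proj₁ (inverse (1# + x) (nonzero (1# + x) v[1+x]))

    [1+x]w≈1 : ((1# + x) * w) ≈ 1#
    [1+x]w≈1 = proj₂ (inverse (1# + x) (nonzero (1# + x) v[1+x]))

    0≤vw : fin V.0# ≤ₑ v w
    0≤vw = begin
      fin V.0#           ≈⟨ ε⁻¹≈ε ⟨
      fin (V.- V.0#)     ≈⟨ v-inverse (1# + x) w [1+x]w≈1 v[1+x] ⟨
      v w                ∎
      where open import Algebra.Properties.Group V.group using (ε⁻¹≈ε)

    y : Carrier
    y = - (w * x)

    δ<vy : fin δ <ₑ v y
    δ<vy = begin-strict
      fin δ              ≈⟨ V.identityˡ δ ⟨
      fin (V.0# V.+ δ)   <⟨ v-*-> w x 0≤vw δ<vx ⟩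
      v (w * x)          ≈⟨ v-neg (w * x) ⟨
      v y                ∎

  ~-mono : ∀ {δ γ x y} → δ V.≤ γ → x ~[ γ ] y → x ~[ δ ] y
  ~-mono _   (inj₁ both≈0) = inj₁ both≈0
  ~-mono δ≤γ (inj₂ (x≉0 , y≉0 , a , a∈𝔪 , x≈y[1+a])) = inj₂ (x≉0 , y≉0 , a , 𝔪-mono δ≤γ a∈𝔪 , x≈y[1+a])

  -- Symmetry and transitivity come from 1 + 𝔪_δ being a group.
  ~-sym : ∀ {δ x y} → V.0# V.≤ δ → x ~[ δ ] y → y ~[ δ ] x
  ~-sym _ (inj₁ (x≈0 , y≈0)) = inj₁ (y≈0 , x≈0)
  ~-sym 0≤δ (inj₂ (x≉0 , y≉0 , a , a∈𝔪 , x≈y[1+a])) with 𝔪-inverse 0≤δ a∈𝔪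
  ... | b , b∈𝔪 , [1+a][1+b]≈1 = inj₂ (y≉0 , x≉0 , b , b∈𝔪 , *-[1+]-invert x≈y[1+a] [1+a][1+b]≈1)

  ~-trans : ∀ {δ x y z} → V.0# V.≤ δ → x ~[ δ ] y → y ~[ δ ] z → x ~[ δ ] z
  ~-trans _ (inj₁ (x≈0 , _))     (inj₁ (_ , z≈0))     = inj₁ (x≈0 , z≈0)
  ~-trans _ (inj₁ (_ , y≈0))     (inj₂ (y≉0 , _))     = contradiction y≈0 y≉0
  ~-trans _ (inj₂ (_ , y≉0 , _)) (inj₁ (y≈0 , _))     = contradiction y≈0 y≉0
  ~-trans 0≤δ (inj₂ (x≉0 , _ , a , a∈𝔪 , x≈y[1+a])) (inj₂ (_ , z≉0 , b , b∈𝔪 , y≈z[1+b])) =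
    inj₂ (x≉0 , z≉0 , (b + a) + b * a , 𝔪-product 0≤δ b∈𝔪 a∈𝔪 , *-[1+]-compose x≈y[1+a] y≈z[1+b])

  ~-error : ∀ {γ m} x y → x ~[ γ ] y → fin m ≤ₑ v y → fin (m V.+ γ) <ₑ v (x - y)
  ~-error x y (inj₁ (x≈0 , y≈0)) _ = v-zero-> (trans (+-cong x≈0 (-‿cong y≈0)) (-‿inverseʳ 0#))
  ~-error {γ} {m} x y (inj₂ (_ , _ , a , (_ , γ<va) , x≈y[1+a])) m≤vy = begin-strict
    fin (m V.+ γ)   <⟨ v-*-> y a m≤vy γ<va ⟩
    v (y * a)       ≈⟨ v-cong x-y≈ya ⟨
    v (x - y)       ∎
    where x-y≈ya = x≈y[1+a]⇒x-y≈ya x≈y[1+a]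

  ~-close : ∀ {δ s} → V.0# V.≤ δ → ∀ x y → v y ≈ₑ fin s → fin (s V.+ δ) <ₑ v (x - y) → x ~[ δ ] y
  ~-close {δ} {s} 0≤δ x y vy≈s s+δ<v[x-y] = inj₂ (x≉0 , y≉0 , a , 𝔪-intro 0≤δ a δ<va , x≈y[1+a])
    where
    y≉0 : ¬ (y ≈ 0#)
    y≉0 = nonzero y vy≈s

    vx≈s : v x ≈ₑ fin s
    vx≈s = begin-equality
      v x              ≈⟨ v-cong (y+[x-y]≈x x y) ⟨
      v (y + (x - y))  ≈⟨ v-+-dominant y (x - y) vy≈s (begin-strict
                             fin s            ≤⟨ x≤x+t s 0≤δ ⟩
                             fin (s V.+ δ)    <⟨ s+δ<v[x-y] ⟩
                             v (x - y)        ∎) ⟩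
      fin s            ∎

    x≉0 : ¬ (x ≈ 0#)
    x≉0 = nonzero x vx≈s

    y⁻¹ : Carrier
    y⁻¹ = proj₁ (inverse y y≉0)

    yy⁻¹≈1 : (y * y⁻¹) ≈ 1#
    yy⁻¹≈1 = proj₂ (inverse y y≉0)

    a : Carrier
    a = y⁻¹ * (x - y)

    δ<va : fin δ <ₑ v a
    δ<va = begin-strict
      fin δ                          ≈⟨ \\-leftDividesʳ s δ ⟨
      fin (V.- s V.+ (s V.+ δ))      <⟨ v-*-> y⁻¹ (x - y) (begin
                                          fin (V.- s)  ≈⟨ v-inverse y y⁻¹ yy⁻¹≈1 vy≈s ⟨
                                          v y⁻¹        ∎) s+δ<v[x-y] ⟩
      v a                            ∎
      where open import Algebra.Properties.Group V.group using (\\-leftDividesʳ)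

    x≈y[1+a] : x ≈ (y * (1# + a))
    x≈y[1+a] = x≈y[1+y⁻¹[x-y]] yy⁻¹≈1

proposition2p4 : ∀ {a ℓ₁ b ℓ₂ : Level} (F : ValuedField a ℓ₁ b ℓ₂) →
    let open ValuedField F in
    (δ : V.Carrier) → V.0# V.≤ δ → ∀ (n : ℕ) (xs : Fin n → Carrier) (s m : V.Carrier) →
    v (Σᵢ xs) ≈ₑ fin s → minᵢ (λ i → v (xs i)) ≈ₑ fin m →
    V.0# V.< (s V.- m) →
    (γ : V.Carrier) → (δ V.+ (s V.- m)) V.≤ γ →
    (z : Carrier) → SumApprox γ xs z →
    z ~[ δ ] Σᵢ xs
proposition2p4 F δ 0≤δ _ xs s m vX≈s min≈m 0<s-m γ δ+[s-m]≤γ _ (u , u~xs , U~z) =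
  ~-trans 0≤δ (~-sym 0≤δ (~-mono δ≤γ U~z)) U~X
  where
  open ValuedField F
  open OrderedGroupFacts valueGroup
  open ValuedFieldFacts F
  open ExtReasoning

  δ≤γ : δ V.≤ γ
  δ≤γ = ≤-trans (x≤x+t δ (proj₁ 0<s-m)) δ+[s-m]≤γ

  m≤vxᵢ : ∀ i → fin m ≤ₑ v (xs i)
  m≤vxᵢ i = begin fin m ≈⟨ min≈m ⟨ minᵢ (v ∘ xs) ≤⟨ minᵢ-≤ (v ∘ xs) i ⟩ v (xs i) ∎

  U~X : Σᵢ u ~[ δ ] Σᵢ xs
  U~X = ~-close 0≤δ (Σᵢ u) (Σᵢ xs) vX≈s (begin-strict
    fin (s V.+ δ)      ≤⟨ x+[y-z]≤w⇒y+x≤z+w δ+[s-m]≤γ ⟩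
    fin (m V.+ γ)      <⟨ Σᵢ-error u xs (λ i → ~-error (u i) (xs i) (u~xs i) (m≤vxᵢ i)) ⟩
    v (Σᵢ u - Σᵢ xs)   ∎)
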